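{- In the coloured symmetric operad $\mathcal{SC}$ of set compositions described in the context, if $P=(\pi_1,\dots,\pi_k)$ and $Q_1,\dots,Q_k$ are noncrossing compositions such that $P\circ(Q_1,\dots,Q_k)$ is defined, then $P\circ(Q_1,\dots,Q_k)$ is a noncrossing composition. Consequently the noncrossing compositions form a coloured symmetric sub-operad $\mathcal{NCC}$ of $\mathcal{SC}$.
   Context: A set composition of $[n]$ is a sequence $(\pi_1,\dots,\pi_k)$ of disjoint nonempty subsets with union $[n]$ (a set partition with numbered blocks); it is noncrossing if there are no $a,b\in\pi_i$, $c,d\in\pi_j$, $i\ne j$, with $a<c<b<d$. The coloured symmetric set operad $\mathcal{SC}$ has colours $\mathbb N^*=\{1,2,\dots\}$; $\mathcal{SC}(n_1,\dots,n_k;n)$ is the set of compositions $(\pi_1,\dots,\pi_k)$ of $[n]$ with $\sharp\pi_i=n_i$; identities are the one-block compositions $([n])$; $\mathfrak S_k$ acts by renumbering blocks, $P^\sigma=(\pi_{\sigma(1)},\dots,\pi_{\sigma(k)})$; and for $P=(\pi_1,\dots,\pi_k)\in\mathcal{SC}(n_1,\dots,n_k;n)$ and $Q_i=(\tau_{i,1},\dots,\tau_{i,l_i})\in\mathcal{SC}(m_{i,1},\dots,m_{i,l_i};n_i)$, the composition is $P\circ(Q_1,\dots,Q_k)=(\tau_{1,1},\dots,\tau_{1,l_1},\dots,\tau_{k,1},\dots,\tau_{k,l_k})$, where each $\tau_{i,j}\subseteq[n_i]$ is transported into $\pi_i\subseteq[n]$ along the unique monotone bijection $[n_i]\to\pi_i$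 (so the block $\pi_i$ is refined by $Q_i$). -}

module Defs where

open import Data.Nat using (ℕ; zero; suc; _+_)
open import Data.Bool using (Bool; true; false)
open import Data.Fin using (Fin; zero; suc; splitAt; _<_)
open import Data.Fin.Subset using (Subset; _∈_; ∣_∣; Nonempty; ⊤)
open import Data.Fin.Permutation using (Permutation′; _⟨$⟩ʳ_)
open import Data.Vec using ([]; _∷_)
open import Data.Product using (Σ; ∃; _,_; _×_)
open import Data.Sum using (inj₁; inj₂)
open import Relation.Binary.PropositionalEquality using (_≡_; _≢_)
open import Relation.Nullary using (¬_)

record SetComp (n k : ℕ) : Set where
  field
    block    : Fin k → Subset n
    nonempty : ∀ i → Nonempty (block i)
    disjoint : ∀ i j x → x ∈ block i → x ∈ block j → i ≡ j
    cover    : ∀ x → ∃ λ i → x ∈ block i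
open SetComp public

NonCrossing : ∀ {n k} → (Fin k → Subset n) → Set
NonCrossing {n} {k} π =
  (i j : Fin k) → i ≢ j → (a b c d : Fin n) →
  a ∈ π i → b ∈ π i → c ∈ π j → d ∈ π j →
  ¬ (a < c × c < b × b < d)

IsNoncrossing : ∀ {n k} → SetComp n k → Set
IsNoncrossing P = NonCrossing (block P)

-- transport τ ⊆ [m] into π ⊆ [n] along the unique monotone map [m] → π
-- (the r-th element of π, counted from 0, is in the result iff r ∈ τ;
--  this is the monotone bijection when ∣ π ∣ = m)
transport : ∀ {n m} → Subset n → Subset m → Subset n
transport [] τ = []
transport (false ∷ π) τ = false ∷ transport π τ
transport (true ∷ π) [] = false ∷ transport π []
transport (true ∷ π) (b ∷ τ) = b ∷ transport π τ

total : (k : ℕ) → (Fin k → ℕ) → ℕ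
total zero l = zero
total (suc k) l = l zero + total k (λ i → l (suc i))

-- position j in (1,1),…,(1,l_1),…,(k,1),…,(k,l_k)  ↦  (i , j')
unflatten : (k : ℕ) (l : Fin k → ℕ) → Fin (total k l) → Σ (Fin k) (λ i → Fin (l i))
unflatten (suc k) l j with splitAt (l zero) j
... | inj₁ a = zero , a
... | inj₂ b with unflatten k (λ i → l (suc i)) b
...   | i , c = suc i , c

-- operadic composition P ∘ (Q_1,…,Q_k): blocks τ_{i,j} transported into π_i
compBlocks : ∀ {n k} (P : SetComp n k) (l : Fin k → ℕ)
  (Q : (i : Fin k) → SetComp ∣ block P i ∣ (l i)) → Fin (total k l) → Subset n
compBlocks P l Q j with unflatten _ l j
... | i , j' = transport (block P i) (block (Q i) j')

actBlocks : ∀ {n k} → SetComp n k → Permutation′ k → Fin k → Subset n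
actBlocks P σ i = block P (σ ⟨$⟩ʳ i)

idBlocks : (n : ℕ) → Fin 1 → Subset n
idBlocks n _ = ⊤

-- A block τ of a refinement of πᵢ is sent into πᵢ by the monotone map whose
-- inverse is the rank within πᵢ. Two blocks of P ∘ (Q₁,…,Q_k) coming from
-- different πᵢ cannot cross because P is noncrossing; two coming from the same
-- πᵢ cannot cross because rank is strictly monotone on πᵢ, so a crossing would
-- be pulled back to a crossing in Qᵢ. Identities have a single block, and
-- renumbering blocks by a permutation is an injective reindexing.
module Submission where

open import Defs
open import Data.Nat using (ℕ; _≤_)
open import Data.Fin using (Fin)
open import Data.Fin.Subset using (∣_∣)
open import Data.Fin.Permutation using (Permutation′)
open import Data.Product using (_×_)

open import Data.Nat as Nat using (zero; suc; z<s; s<s)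
open import Data.Fin using (zero; suc; toℕ; join; splitAt; _<_)
open import Data.Fin.Properties using (join-splitAt)
open import Data.Fin.Subset using (Subset; _∈_; _∉_)
open import Data.Vec using (_∷_; []; here; there)
open import Data.Bool using (true; false)
open import Data.Product using (Σ; ∃-syntax; _,_; proj₁)
open import Data.Sum using (inj₁; inj₂)
open import Data.Empty using (⊥; ⊥-elim)
open import Function using (_∘_)
open import Function.Bundles using (Injection)
open import Function.Definitions using (Injective)
open import Function.Properties.Inverse using (↔⇒↣)
open import Relation.Nullary using (¬_; yes; no)
open import Relation.Nullary.Decidable using (¬¬-excluded-middle)
open import Relation.Binary.PropositionalEquality

private
  variable
    n m : ℕ

-- NonCrossing of Defs with blocks indexed by an arbitrary type; on Fin k the
-- two agree definitionally, so the lemmas below apply to NonCrossing directly.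
NonCrossingFamily : {I : Set} → (I → Subset n) → Set
NonCrossingFamily {n} {I} π =
  (i j : I) → i ≢ j → (a b c d : Fin n) →
  a ∈ π i → b ∈ π i → c ∈ π j → d ∈ π j →
  ¬ (a < c × c < b × b < d)

NonCrossingFamily-resp-≗ : {I : Set} {π ρ : I → Subset n} →
  π ≗ ρ → NonCrossingFamily π → NonCrossingFamily ρ
NonCrossingFamily-resp-≗ π≗ρ ncπ i j i≢j a b c d a∈ b∈ c∈ d∈ =
  ncπ i j i≢j a b c d (from a∈) (from b∈) (from c∈) (from d∈)
  where
  from : ∀ {i x} → x ∈ _ → x ∈ _
  from {i} = subst (_ ∈_) (sym (π≗ρ i))

NonCrossingFamily-reindex : {I J : Set} {π : I → Subset n} {f : J → I} →
  Injective _≡_ _≡_ f → NonCrossingFamily π → NonCrossingFamily (π ∘ f)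
NonCrossingFamily-reindex f-inj ncπ i j i≢j = ncπ _ _ (i≢j ∘ f-inj)

NonCrossing-Fin1 : (π : Fin 1 → Subset n) → NonCrossing π
NonCrossing-Fin1 π zero zero 0≢0 = ⊥-elim (0≢0 refl)

rank : Subset n → Fin n → ℕ
rank (_     ∷ π) zero    = zero
rank (true  ∷ π) (suc x) = suc (rank π x)
rank (false ∷ π) (suc x) = rank π x

rank-strictMono : (π : Subset n) {x y : Fin n} →
  x ∈ π → x < y → rank π x Nat.< rank π y
rank-strictMono (true  ∷ π) {zero}  {suc y} here      _         = z<s
rank-strictMono (true  ∷ π) {suc x} {suc y} (there p) (s<s x<y) = s<s (rank-strictMono π p x<y)
rank-strictMono (false ∷ π) {suc x} {suc y} (there p) (s<s x<y) = rank-strictMono π p x<y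

∉-transport-[] : (π : Subset n) {x : Fin n} → x ∉ transport π []
∉-transport-[] (false ∷ π) (there p) = ∉-transport-[] π p
∉-transport-[] (true  ∷ π) (there p) = ∉-transport-[] π p

∈-transport⁻ : (π : Subset n) (τ : Subset m) {x : Fin n} → x ∈ transport π τ →
  x ∈ π × ∃[ r ] toℕ r ≡ rank π x × r ∈ τ
∈-transport⁻ (false ∷ π) τ (there p) with ∈-transport⁻ π τ p
... | x∈π , r , r≡ , r∈τ = there x∈π , r , r≡ , r∈τ
∈-transport⁻ (true ∷ π) []         p = ⊥-elim (∉-transport-[] (true ∷ π) p)
∈-transport⁻ (true ∷ π) (true ∷ τ) here = here , zero , refl , here
∈-transport⁻ (true ∷ π) (_ ∷ τ) (there p) with ∈-transport⁻ π τ p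
... | x∈π , r , r≡ , r∈τ = there x∈π , suc r , cong suc r≡ , there r∈τ

refine : {I : Set} {J : I → Set} {m : I → ℕ} →
  (I → Subset n) → ((i : I) → J i → Subset (m i)) → Σ I J → Subset n
refine π τ (i , s) = transport (π i) (τ i s)

NonCrossingFamily-refine : {I : Set} {J : I → Set} {m : I → ℕ}
  (π : I → Subset n) (τ : (i : I) → J i → Subset (m i)) →
  NonCrossingFamily π → (∀ i → NonCrossingFamily (τ i)) →
  NonCrossingFamily (refine π τ)
NonCrossingFamily-refine {J = J} {m = m} π τ ncπ ncτ
  (i , s) (j , t) is≢jt a b c d a∈ b∈ c∈ d∈ (a<c , c<b , b<d)
  -- the goal is ⊥, so whether i ≡ j may be decided classically
  = ¬¬-excluded-middle λ
    { (no i≢j) → ncπ i j i≢j a b c d (in-π a∈) (in-π b∈) (in-π c∈) (in-π d∈) (a<c , c<b , b<d)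
    ; (yes refl) → ranks-cross (λ s≡t → is≢jt (cong (i ,_) s≡t)) a∈ b∈ c∈ d∈ }
  where
  in-π : ∀ {i s x} → x ∈ refine π τ (i , s) → x ∈ π i
  in-π = proj₁ ∘ ∈-transport⁻ _ _

  ranks-< : ∀ {i x y} {r r′ : Fin (m i)} → x ∈ π i → x < y →
    toℕ r ≡ rank (π i) x → toℕ r′ ≡ rank (π i) y → r < r′
  ranks-< {i} x∈ x<y r≡ r′≡ = subst₂ Nat._<_ (sym r≡) (sym r′≡) (rank-strictMono (π i) x∈ x<y)

  ranks-cross : ∀ {i} {s t : J i} → s ≢ t →
    a ∈ refine π τ (i , s) → b ∈ refine π τ (i , s) →
    c ∈ refine π τ (i , t) → d ∈ refine π τ (i , t) → ⊥
  ranks-cross {i} {s} {t} s≢t a∈ b∈ c∈ d∈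
    with ∈-transport⁻ (π i) _ a∈ | ∈-transport⁻ (π i) _ b∈
       | ∈-transport⁻ (π i) _ c∈ | ∈-transport⁻ (π i) _ d∈
  ... | a∈π , ra , ra≡ , ra∈ | b∈π , rb , rb≡ , rb∈
      | c∈π , rc , rc≡ , rc∈ | _   , rd , rd≡ , rd∈ =
    ncτ i s t s≢t ra rb rc rd ra∈ rb∈ rc∈ rd∈
      (ranks-< a∈π a<c ra≡ rc≡ , ranks-< c∈π c<b rc≡ rb≡ , ranks-< b∈π b<d rb≡ rd≡)

flatten : (k : ℕ) (l : Fin k → ℕ) → Σ (Fin k) (Fin ∘ l) → Fin (total k l)
flatten (suc k) l (zero  , a) = join (l zero) _ (inj₁ a)
flatten (suc k) l (suc i , c) = join (l zero) _ (inj₂ (flatten k (l ∘ suc) (i , c)))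

flatten-unflatten : (k : ℕ) (l : Fin k → ℕ) (j : Fin (total k l)) →
  flatten k l (unflatten k l j) ≡ j
flatten-unflatten (suc k) l j with splitAt (l zero) j in split≡
... | inj₁ a = trans (cong (join (l zero) _) (sym split≡)) (join-splitAt (l zero) _ j)
... | inj₂ b with unflatten k (l ∘ suc) b | flatten-unflatten k (l ∘ suc) b
...   | i , c | flatten≡b = begin
  join (l zero) _ (inj₂ (flatten k (l ∘ suc) (i , c))) ≡⟨ cong (join (l zero) _ ∘ inj₂) flatten≡b ⟩
  join (l zero) _ (inj₂ b)                             ≡⟨ cong (join (l zero) _) (sym split≡) ⟩
  join (l zero) _ (splitAt (l zero) j)                 ≡⟨ join-splitAt (l zero) _ j ⟩
  j                                                    ∎
  where open ≡-Reasoning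

unflatten-injective : (k : ℕ) (l : Fin k → ℕ) → Injective _≡_ _≡_ (unflatten k l)
unflatten-injective k l {j} {j′} eq = begin
  j                             ≡⟨ sym (flatten-unflatten k l j) ⟩
  flatten k l (unflatten k l j)  ≡⟨ cong (flatten k l) eq ⟩
  flatten k l (unflatten k l j′) ≡⟨ flatten-unflatten k l j′ ⟩
  j′                            ∎
  where open ≡-Reasoning

compBlocks-unflatten : {k : ℕ} (P : SetComp n k) (l : Fin k → ℕ)
  (Q : (i : Fin k) → SetComp ∣ block P i ∣ (l i)) →
  refine (block P) (block ∘ Q) ∘ unflatten k l ≗ compBlocks P l Q
compBlocks-unflatten {k = k} P l Q j with unflatten k l j
... | _ = refl

NonCrossing-compBlocks : {k : ℕ} (P : SetComp n k) (l : Fin k → ℕ)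
  (Q : (i : Fin k) → SetComp ∣ block P i ∣ (l i)) →
  IsNoncrossing P → (∀ i → IsNoncrossing (Q i)) →
  NonCrossing (compBlocks P l Q)
NonCrossing-compBlocks {k = k} P l Q ncP ncQ =
  NonCrossingFamily-resp-≗ (compBlocks-unflatten P l Q)
    (NonCrossingFamily-reindex (unflatten-injective k l)
      (NonCrossingFamily-refine (block P) (block ∘ Q) ncP ncQ))

NonCrossing-actBlocks : {k : ℕ} (P : SetComp n k) (σ : Permutation′ k) →
  IsNoncrossing P → NonCrossing (actBlocks P σ)
NonCrossing-actBlocks P σ = NonCrossingFamily-reindex (Injection.injective (↔⇒↣ σ))

mainTheorem10 : ((n k : ℕ) (P : SetComp n k) (l : Fin k → ℕ)
    (Q : (i : Fin k) → SetComp ∣ block P i ∣ (l i)) →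
    IsNoncrossing P → (∀ i → IsNoncrossing (Q i)) →
    NonCrossing (compBlocks P l Q))
    × ((n : ℕ) → 1 ≤ n → NonCrossing (idBlocks n))
    × ((n k : ℕ) (P : SetComp n k) (σ : Permutation′ k) →
    IsNoncrossing P → NonCrossing (actBlocks P σ))
mainTheorem10 =
    (λ n k → NonCrossing-compBlocks)
  , (λ n _ → NonCrossing-Fin1 (idBlocks n))
  , (λ n k → NonCrossing-actBlocks)
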